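{- Let $a,b$ be integers with $a-1>b\ge 1$, let $\varphi(0)=0^a1$, $\varphi(1)=0^b1$, let $u_\beta=\lim_{n\to\infty}\varphi^n(0)$, let $T(w)=0^b1\varphi(w)0^b$, and define $V^{(1)}=0^{b}$ and $V^{(n)}=T(V^{(n-1)})$ for $n\ge 2$. Let $p$ be a palindrome in ${\cal L}(u_\beta)$. Then $p$ has two palindromic extensions (i.e. both $0p0$ and $1p1$ belong to ${\cal L}(u_\beta)$) if and only if $p=V^{(n)}$ for some positive integer $n$.
   Context: ${\cal L}(u_\beta)$ is the set of finite factors of $u_\beta$. A word is a palindrome if it equals its reversal. A letter $z$ is a palindromic extension of a palindrome $p$ if $zpz\in{\cal L}(u_\beta)$. -}

module Defs where

open import Data.Nat using (ℕ; zero; suc)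
open import Data.List using (List; []; _∷_; _++_; replicate; concatMap; reverse; [_])
open import Data.Product using (Σ; ∃; _×_)
open import Relation.Binary.PropositionalEquality using (_≡_)

data Letter : Set where
  𝟎 𝟏 : Letter

Word : Set
Word = List Letter

φ₁ : ℕ → ℕ → Letter → Word
φ₁ a b 𝟎 = replicate a 𝟎 ++ [ 𝟏 ]
φ₁ a b 𝟏 = replicate b 𝟎 ++ [ 𝟏 ]

φ : ℕ → ℕ → Word → Word
φ a b = concatMap (φ₁ a b)

φⁿ0 : ℕ → ℕ → ℕ → Word
φⁿ0 a b zero    = [ 𝟎 ]
φⁿ0 a b (suc n) = φ a b (φⁿ0 a b n)

Factor : Word → Word → Set
Factor w v = Σ Word λ x → Σ Word λ y → x ++ w ++ y ≡ v

-- L(u_β): since φ(0) starts with 0, φ^n(0) is a prefix of φ^(n+1)(0) and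
-- u_β = lim φ^n(0); the finite factors of u_β are exactly the words that are
-- factors of φ^n(0) for some n.
InL : ℕ → ℕ → Word → Set
InL a b w = ∃ λ n → Factor w (φⁿ0 a b n)

Palindrome : Word → Set
Palindrome p = reverse p ≡ p

T : ℕ → ℕ → Word → Word
T a b w = replicate b 𝟎 ++ [ 𝟏 ] ++ φ a b w ++ replicate b 𝟎

-- V^(1) = 0^b, V^(n) = T(V^(n-1)) for n ≥ 2.
-- (V 0 is not used: the statement only refers to V n with n ≥ 1.)
V : ℕ → ℕ → ℕ → Word
V a b zero          = replicate b 𝟎
V a b (suc zero)    = replicate b 𝟎
V a b (suc (suc n)) = T a b (V a b (suc n))

-- Every 1 in φ(v) closes the image 0^a1 or 0^b1 of a letter of v, so a factor 1p1 of u_β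
-- forces p = φ(u)0^k with k ∈ {a, b}.  As 0^(a+1) is not a factor, 0p0 ∈ L rules out
-- p beginning with 0^a; hence p = 0^b or p = 0^b1φ(w)0^k, and then palindromicity and the
-- injectivity of φ (a ≠ b) give k = b and p = T(w) with w a palindrome.  Desubstituting the
-- occurrences of 0T(w)0 and 1T(w)1 shows that w again has both extensions, and induction on
-- the length gives p = V^(n).  Conversely 0T(w)0 is a factor of φ(0w0) because b < a, and
-- 1T(w)1 of φ(d1w1) for the letter d preceding 1w1, so both extensions propagate from
-- V^(1) = 0^b, whose extensions 0^(b+2) and 10^b1 occur in φ(0) and φ(01).

module Submission where

open import Defs
open import Data.Nat using (ℕ; zero; suc; _≤_; _<_; _+_; z≤n; s≤s)
open import Data.Nat.Properties using (≤-refl; ≤-trans; ≤-reflexive; m≤n⇒m≤1+n; 1+n≰n; <⇒≢; <⇒≤; +-comm; m+n≤o⇒m≤o; m≤n⇒∃[o]m+o≡n)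
open import Data.Nat.Induction using (<-wellFounded)
open import Induction.WellFounded using (Acc; acc)
open import Data.List using (List; []; _∷_; _++_; [_]; replicate; reverse; length; _∷ʳ_)
open import Data.List.Base using (initLast; _∷ʳ′_)
open import Data.List.Properties using (++-assoc; ++-identityʳ; ++-cancelˡ; ++-cancelʳ; ∷-injectiveʳ; ∷ʳ-injectiveʳ; reverse-++; unfold-reverse; length-++-≤ˡ; length-++-≤ʳ; concatMap-++)
open import Data.Product using (Σ; ∃; _×_; _,_)
open import Data.Sum using (_⊎_; inj₁; inj₂)
open import Data.Empty using (⊥-elim)
open import Relation.Nullary using (¬_)
open import Relation.Binary.PropositionalEquality using (_≡_; _≢_; refl; sym; trans; cong; cong₂; subst; subst₂; module ≡-Reasoning)
open import Function.Bundles using (_⇔_; mk⇔)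

replicate-++ : ∀ {A : Set} m n (x : A) → replicate m x ++ replicate n x ≡ replicate (m + n) x
replicate-++ zero    n x = refl
replicate-++ (suc m) n x = cong (x ∷_) (replicate-++ m n x)

replicate-++-∷ : ∀ {A : Set} n (x : A) ys → replicate n x ++ x ∷ ys ≡ x ∷ replicate n x ++ ys
replicate-++-∷ zero    x ys = refl
replicate-++-∷ (suc n) x ys = cong (x ∷_) (replicate-++-∷ n x ys)

replicate-∷ʳ : ∀ {A : Set} n (x : A) → replicate n x ∷ʳ x ≡ x ∷ replicate n x
replicate-∷ʳ n x = trans (replicate-++-∷ n x []) (cong (x ∷_) (++-identityʳ _))

reverse-replicate : ∀ {A : Set} n (x : A) → reverse (replicate n x) ≡ replicate n x
reverse-replicate zero    x = refl
reverse-replicate (suc n) x = begin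
  reverse (x ∷ replicate n x)   ≡⟨ unfold-reverse x (replicate n x) ⟩
  reverse (replicate n x) ∷ʳ x  ≡⟨ cong (_∷ʳ x) (reverse-replicate n x) ⟩
  replicate n x ∷ʳ x            ≡⟨ replicate-∷ʳ n x ⟩
  x ∷ replicate n x             ∎
  where open ≡-Reasoning

++-regroup : ∀ {A : Set} (x u v y : List A) → (x ++ u) ++ v ++ y ≡ x ++ (u ++ v) ++ y
++-regroup x u v y = trans (++-assoc x u (v ++ y)) (cong (x ++_) (sym (++-assoc u v y)))

factor-trans : ∀ {u v w} → Factor u v → Factor v w → Factor u w
factor-trans {u} (x , y , refl) (x′ , y′ , refl) = x′ ++ x , y ++ y′ , (begin
  (x′ ++ x) ++ u ++ y ++ y′    ≡⟨ ++-assoc x′ x _ ⟩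
  x′ ++ x ++ u ++ y ++ y′      ≡⟨ cong (λ t → x′ ++ x ++ t) (++-assoc u y y′) ⟨
  x′ ++ x ++ (u ++ y) ++ y′    ≡⟨ cong (x′ ++_) (++-assoc x (u ++ y) y′) ⟨
  x′ ++ (x ++ u ++ y) ++ y′    ∎)
  where open ≡-Reasoning

factor-sandwich : ∀ x {u} s y → Factor (u ++ s ++ u) ((x ++ u) ++ s ++ u ++ y)
factor-sandwich x {u} s y = x , y , (begin
  x ++ (u ++ s ++ u) ++ y  ≡⟨ cong (x ++_) (++-assoc u (s ++ u) y) ⟩
  x ++ u ++ (s ++ u) ++ y  ≡⟨ cong (λ t → x ++ u ++ t) (++-assoc s u y) ⟩
  x ++ u ++ s ++ u ++ y    ≡⟨ ++-assoc x u _ ⟨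
  (x ++ u) ++ s ++ u ++ y  ∎)
  where open ≡-Reasoning

surround : Letter → Word → Word
surround z p = z ∷ p ++ [ z ]

infix 8 0^_

0^_ : ℕ → Word
0^ n = replicate n 𝟎

0^-head : ∀ {n} → 1 ≤ n → ∀ s → ∃ λ t → 0^ n ++ s ≡ 𝟎 ∷ t
0^-head (s≤s z≤n) s = _ , refl

0^-last : ∀ {n} → 1 ≤ n → ∀ s → ∃ λ x → x ++ 𝟎 ∷ s ≡ 0^ n ++ s
0^-last {suc n} (s≤s z≤n) s = 0^ n , replicate-++-∷ n 𝟎 s

0^-prefix : ∀ {m n} → m ≤ n → ∀ s → ∃ λ y → 0^ m ++ y ≡ 0^ n ++ s
0^-prefix {n = n} z≤n s = 0^ n ++ s , refl
0^-prefix (s≤s m≤n) s with 0^-prefix m≤n s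
... | y , eq = y , cong (𝟎 ∷_) eq

0^-𝟏-≢-[] : ∀ k {s} → 0^ k ++ 𝟏 ∷ s ≢ []
0^-𝟏-≢-[] zero    ()
0^-𝟏-≢-[] (suc k) ()

0^-𝟏-injective : ∀ k m {s t} → 0^ k ++ 𝟏 ∷ s ≡ 0^ m ++ 𝟏 ∷ t → k ≡ m × s ≡ t
0^-𝟏-injective zero    zero    refl = refl , refl
0^-𝟏-injective (suc k) (suc m) eq with 0^-𝟏-injective k m (∷-injectiveʳ eq)
... | refl , s≡t = refl , s≡t
0^-𝟏-injective zero    (suc m) ()
0^-𝟏-injective (suc k) zero    ()

split-0^-𝟏 : ∀ k x {r s} → x ++ 𝟏 ∷ r ≡ 0^ k ++ 𝟏 ∷ s →
  (x ≡ 0^ k × r ≡ s) ⊎ ∃ λ x′ → x ≡ 0^ k ++ 𝟏 ∷ x′ × x′ ++ 𝟏 ∷ r ≡ s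
split-0^-𝟏 zero    []      refl = inj₁ (refl , refl)
split-0^-𝟏 zero    (𝟏 ∷ x) refl = inj₂ (x , refl , refl)
split-0^-𝟏 (suc k) (𝟎 ∷ x) eq with split-0^-𝟏 k x (∷-injectiveʳ eq)
... | inj₁ (refl , r≡s)         = inj₁ (refl , r≡s)
... | inj₂ (x′ , refl , x′r≡s) = inj₂ (x′ , refl , x′r≡s)
split-0^-𝟏 zero    (𝟎 ∷ x) ()
split-0^-𝟏 (suc k) []      ()
split-0^-𝟏 (suc k) (𝟏 ∷ x) ()

0^-prefix-bound : ∀ m k {y s} → 0^ m ++ y ≡ 0^ k ++ 𝟏 ∷ s → m ≤ k
0^-prefix-bound zero    k       eq = z≤n
0^-prefix-bound (suc m) (suc k) eq = s≤s (0^-prefix-bound m k (∷-injectiveʳ eq))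
0^-prefix-bound (suc m) zero    ()

0^-factor-block : ∀ {m} k {s} → Factor (0^ m) (0^ k ++ 𝟏 ∷ s) → m ≤ k ⊎ Factor (0^ m) s
0^-factor-block k       ([]    , y , eq) = inj₁ (0^-prefix-bound _ k eq)
0^-factor-block zero    (𝟏 ∷ x , y , eq) = inj₂ (x , y , ∷-injectiveʳ eq)
0^-factor-block (suc k) (𝟎 ∷ x , y , eq) with 0^-factor-block k (x , y , ∷-injectiveʳ eq)
... | inj₁ m≤k = inj₁ (m≤n⇒m≤1+n m≤k)
... | inj₂ f   = inj₂ f
0^-factor-block zero    (𝟎 ∷ x , y , ())
0^-factor-block (suc k) (𝟏 ∷ x , y , ())

module Morphism (a b : ℕ) where

  zerosOf : Letter → ℕ
  zerosOf 𝟎 = a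
  zerosOf 𝟏 = b

  φ-∷ : ∀ c v → φ a b (c ∷ v) ≡ 0^ zerosOf c ++ 𝟏 ∷ φ a b v
  φ-∷ 𝟎 v = ++-assoc (0^ a) [ 𝟏 ] (φ a b v)
  φ-∷ 𝟏 v = ++-assoc (0^ b) [ 𝟏 ] (φ a b v)

  φ-∷-++ : ∀ c v z → φ a b (c ∷ v) ++ z ≡ 0^ zerosOf c ++ 𝟏 ∷ φ a b v ++ z
  φ-∷-++ c v z = trans (cong (_++ z) (φ-∷ c v)) (++-assoc (0^ zerosOf c) (𝟏 ∷ φ a b v) z)

  φ-++ : ∀ u v → φ a b (u ++ v) ≡ φ a b u ++ φ a b v
  φ-++ = concatMap-++ (φ₁ a b)

  φ-∷ʳ : ∀ v c → φ a b (v ∷ʳ c) ≡ (φ a b v ++ 0^ zerosOf c) ∷ʳ 𝟏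
  φ-∷ʳ v c = begin
    φ a b (v ++ [ c ])              ≡⟨ φ-++ v [ c ] ⟩
    φ a b v ++ φ a b [ c ]          ≡⟨ cong (φ a b v ++_) (φ-∷ c []) ⟩
    φ a b v ++ 0^ zerosOf c ∷ʳ 𝟏    ≡⟨ ++-assoc (φ a b v) (0^ zerosOf c) [ 𝟏 ] ⟨
    (φ a b v ++ 0^ zerosOf c) ∷ʳ 𝟏  ∎
    where open ≡-Reasoning

  φ-surround : ∀ c w → φ a b (surround c w) ≡ 0^ zerosOf c ++ 𝟏 ∷ φ a b w ++ 0^ zerosOf c ∷ʳ 𝟏
  φ-surround c w = begin
    φ a b (c ∷ w ∷ʳ c)                   ≡⟨ φ-∷ c (w ∷ʳ c) ⟩
    0^ k ++ 𝟏 ∷ φ a b (w ∷ʳ c)           ≡⟨ cong (λ t → 0^ k ++ 𝟏 ∷ t) (φ-++ w [ c ]) ⟩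
    0^ k ++ 𝟏 ∷ φ a b w ++ φ a b [ c ]   ≡⟨ cong (λ t → 0^ k ++ 𝟏 ∷ φ a b w ++ t) (φ-∷ c []) ⟩
    0^ k ++ 𝟏 ∷ φ a b w ++ 0^ k ∷ʳ 𝟏     ∎
    where
      open ≡-Reasoning
      k : ℕ
      k = zerosOf c

  φ-factor : ∀ {u v} → Factor u v → Factor (φ a b u) (φ a b v)
  φ-factor {u} (x , y , refl) = φ a b x , φ a b y ,
    sym (trans (φ-++ x (u ++ y)) (cong (φ a b x ++_) (φ-++ u y)))

  φ-≢-∷ʳ-𝟎 : ∀ v x → φ a b v ≢ x ∷ʳ 𝟎
  φ-≢-∷ʳ-𝟎 v x eq with initLast v
  φ-≢-∷ʳ-𝟎 v []      () | []
  φ-≢-∷ʳ-𝟎 v (_ ∷ _) () | []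
  ... | v′ ∷ʳ′ c with ∷ʳ-injectiveʳ _ x (trans (sym (φ-∷ʳ v′ c)) eq)
  ...   | ()

  φ-split-at-𝟏 : ∀ v x {r} → x ++ 𝟏 ∷ r ≡ φ a b v →
    ∃ λ v₁ → ∃ λ c → ∃ λ v₂ → v ≡ v₁ ++ c ∷ v₂ × x ≡ φ a b v₁ ++ 0^ zerosOf c × r ≡ φ a b v₂
  φ-split-at-𝟏 []      []      ()
  φ-split-at-𝟏 []      (_ ∷ _) ()
  φ-split-at-𝟏 (c ∷ v) x eq with split-0^-𝟏 (zerosOf c) x (trans eq (φ-∷ c v))
  ... | inj₁ (x≡ , r≡) = [] , c , v , refl , x≡ , r≡
  ... | inj₂ (x′ , refl , x′r≡) with φ-split-at-𝟏 v x′ x′r≡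
  ...   | v₁ , c′ , v₂ , refl , refl , r≡ = c ∷ v₁ , c′ , v₂ , refl , sym (φ-∷-++ c v₁ _) , r≡

  reverse-φ : ∀ w → reverse (φ a b w) ∷ʳ 𝟏 ≡ 𝟏 ∷ φ a b (reverse w)
  reverse-φ []      = refl
  reverse-φ (c ∷ w) = begin
    reverse (φ a b (c ∷ w)) ∷ʳ 𝟏                        ≡⟨ cong (λ t → reverse t ∷ʳ 𝟏) (φ-∷ c w) ⟩
    reverse (0^ k ++ 𝟏 ∷ φ a b w) ∷ʳ 𝟏                  ≡⟨ cong (_∷ʳ 𝟏) (reverse-++ (0^ k) (𝟏 ∷ φ a b w)) ⟩
    (reverse (𝟏 ∷ φ a b w) ++ reverse (0^ k)) ∷ʳ 𝟏      ≡⟨ cong₂ (λ t t′ → (t ++ t′) ∷ʳ 𝟏) (unfold-reverse 𝟏 (φ a b w)) (reverse-replicate k 𝟎) ⟩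
    (reverse (φ a b w) ∷ʳ 𝟏 ++ 0^ k) ∷ʳ 𝟏               ≡⟨ cong (λ t → (t ++ 0^ k) ∷ʳ 𝟏) (reverse-φ w) ⟩
    𝟏 ∷ (φ a b (reverse w) ++ 0^ k) ∷ʳ 𝟏                ≡⟨ cong (𝟏 ∷_) (φ-∷ʳ (reverse w) c) ⟨
    𝟏 ∷ φ a b (reverse w ∷ʳ c)                          ≡⟨ cong (λ t → 𝟏 ∷ φ a b t) (unfold-reverse c w) ⟨
    𝟏 ∷ φ a b (reverse (c ∷ w))                         ∎
    where
      open ≡-Reasoning
      k : ℕ
      k = zerosOf c

  reverse-0^-𝟏-φ-0^ : ∀ j w k → reverse (0^ j ++ 𝟏 ∷ φ a b w ++ 0^ k) ≡ 0^ k ++ 𝟏 ∷ φ a b (reverse w) ++ 0^ j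
  reverse-0^-𝟏-φ-0^ j w k = begin
    reverse (0^ j ++ 𝟏 ∷ φ a b w ++ 0^ k)               ≡⟨ reverse-++ (0^ j) _ ⟩
    reverse (𝟏 ∷ φ a b w ++ 0^ k) ++ reverse (0^ j)     ≡⟨ cong₂ _++_ (unfold-reverse 𝟏 (φ a b w ++ 0^ k)) (reverse-replicate j 𝟎) ⟩
    reverse (φ a b w ++ 0^ k) ∷ʳ 𝟏 ++ 0^ j              ≡⟨ cong (λ t → t ∷ʳ 𝟏 ++ 0^ j) (reverse-++ (φ a b w) (0^ k)) ⟩
    (reverse (0^ k) ++ reverse (φ a b w)) ∷ʳ 𝟏 ++ 0^ j  ≡⟨ cong (λ t → (t ++ reverse (φ a b w)) ∷ʳ 𝟏 ++ 0^ j) (reverse-replicate k 𝟎) ⟩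
    (0^ k ++ reverse (φ a b w)) ∷ʳ 𝟏 ++ 0^ j            ≡⟨ cong (_++ 0^ j) (++-assoc (0^ k) (reverse (φ a b w)) [ 𝟏 ]) ⟩
    (0^ k ++ reverse (φ a b w) ∷ʳ 𝟏) ++ 0^ j            ≡⟨ ++-assoc (0^ k) _ (0^ j) ⟩
    0^ k ++ reverse (φ a b w) ∷ʳ 𝟏 ++ 0^ j              ≡⟨ cong (λ t → 0^ k ++ t ++ 0^ j) (reverse-φ w) ⟩
    0^ k ++ 𝟏 ∷ φ a b (reverse w) ++ 0^ j               ∎
    where open ≡-Reasoning

  T-∷ʳ-𝟏 : ∀ w → T a b w ∷ʳ 𝟏 ≡ φ a b (surround 𝟏 w)
  T-∷ʳ-𝟏 w = begin
    (0^ b ++ 𝟏 ∷ φ a b w ++ 0^ b) ∷ʳ 𝟏  ≡⟨ ++-assoc (0^ b) (𝟏 ∷ φ a b w ++ 0^ b) [ 𝟏 ] ⟩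
    0^ b ++ 𝟏 ∷ (φ a b w ++ 0^ b) ∷ʳ 𝟏  ≡⟨ cong (λ t → 0^ b ++ 𝟏 ∷ t) (++-assoc (φ a b w) (0^ b) [ 𝟏 ]) ⟩
    0^ b ++ 𝟏 ∷ φ a b w ++ 0^ b ∷ʳ 𝟏    ≡⟨ φ-surround 𝟏 w ⟨
    φ a b (surround 𝟏 w)                ∎
    where open ≡-Reasoning

  surround-𝟎-T : ∀ w → surround 𝟎 (T a b w) ≡ 0^ suc b ++ 𝟏 ∷ φ a b w ++ 0^ suc b
  surround-𝟎-T w = begin
    𝟎 ∷ (0^ b ++ 𝟏 ∷ φ a b w ++ 0^ b) ∷ʳ 𝟎  ≡⟨ cong (𝟎 ∷_) (++-assoc (0^ b) (𝟏 ∷ φ a b w ++ 0^ b) [ 𝟎 ]) ⟩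
    𝟎 ∷ 0^ b ++ 𝟏 ∷ (φ a b w ++ 0^ b) ∷ʳ 𝟎  ≡⟨ cong (λ t → 𝟎 ∷ 0^ b ++ 𝟏 ∷ t) (++-assoc (φ a b w) (0^ b) [ 𝟎 ]) ⟩
    𝟎 ∷ 0^ b ++ 𝟏 ∷ φ a b w ++ 0^ b ∷ʳ 𝟎    ≡⟨ cong (λ t → 𝟎 ∷ 0^ b ++ 𝟏 ∷ φ a b w ++ t) (replicate-∷ʳ b 𝟎) ⟩
    0^ suc b ++ 𝟏 ∷ φ a b w ++ 0^ suc b      ∎
    where open ≡-Reasoning

  length-φ : ∀ w → length w ≤ length (φ a b w)
  length-φ []      = z≤n
  length-φ (c ∷ w) = ≤-trans (s≤s (length-φ w))
    (≤-trans (length-++-≤ʳ (𝟏 ∷ φ a b w) {0^ zerosOf c}) (≤-reflexive (cong length (sym (φ-∷ c w)))))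

  length-T : ∀ w → length w < length (T a b w)
  length-T w = ≤-trans (s≤s (≤-trans (length-φ w) (length-++-≤ˡ (φ a b w))))
    (length-++-≤ʳ (𝟏 ∷ φ a b w ++ 0^ b) {0^ b})

  φ-0^-bound : b ≤ a → ∀ v {m} → Factor (0^ m) (φ a b v) → m ≤ a
  φ-0^-bound b≤a []      {zero}  _ = z≤n
  φ-0^-bound b≤a []      {suc m} ([]    , _ , ())
  φ-0^-bound b≤a []      {suc m} (_ ∷ _ , _ , ())
  φ-0^-bound b≤a (c ∷ v) f with 0^-factor-block (zerosOf c) (subst (Factor _) (φ-∷ c v) f)
  ... | inj₁ m≤k = ≤-trans m≤k (zerosOf≤a c)
    where
      zerosOf≤a : ∀ c → zerosOf c ≤ a
      zerosOf≤a 𝟎 = ≤-refl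
      zerosOf≤a 𝟏 = b≤a
  ... | inj₂ f′  = φ-0^-bound b≤a v f′

  φ-factor-surround-𝟏 : ∀ {p} v → Factor (surround 𝟏 p) (φ a b v) → ∃ λ u → ∃ λ c → p ≡ φ a b u ++ 0^ zerosOf c
  φ-factor-surround-𝟏 {p} v (x , y , eq) with φ-split-at-𝟏 v x eq
  ... | _ , _ , v₂ , _ , _ , r≡ with φ-split-at-𝟏 v₂ p (trans (sym (++-assoc p [ 𝟏 ] y)) r≡)
  ...   | u , c , _ , _ , p≡ , _ = u , c , p≡

  surround-T-factor-𝟏 : ∀ d w → Factor (surround 𝟏 (T a b w)) (φ a b (d ∷ surround 𝟏 w))
  surround-T-factor-𝟏 d w = 0^ zerosOf d , [] , (begin
    0^ k ++ surround 𝟏 (T a b w) ++ []  ≡⟨ cong (0^ k ++_) (++-identityʳ _) ⟩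
    0^ k ++ 𝟏 ∷ T a b w ∷ʳ 𝟏            ≡⟨ cong (λ t → 0^ k ++ 𝟏 ∷ t) (T-∷ʳ-𝟏 w) ⟩
    0^ k ++ 𝟏 ∷ φ a b (surround 𝟏 w)    ≡⟨ φ-∷ d (surround 𝟏 w) ⟨
    φ a b (d ∷ surround 𝟏 w)            ∎)
    where
      open ≡-Reasoning
      k : ℕ
      k = zerosOf d

  surround-T-factor-𝟎 : b < a → ∀ w → Factor (surround 𝟎 (T a b w)) (φ a b (surround 𝟎 w))
  surround-T-factor-𝟎 b<a w with m≤n⇒∃[o]m+o≡n b<a
  ... | d , 1+b+d≡a = subst₂ Factor (sym (surround-𝟎-T w)) φ-surround-𝟎
      (factor-sandwich (0^ d) (𝟏 ∷ φ a b w) (0^ d ∷ʳ 𝟏))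
    where
      0^a-as-suffix : 0^ d ++ 0^ suc b ≡ 0^ a
      0^a-as-suffix = trans (replicate-++ d (suc b) 𝟎) (cong 0^_ (trans (+-comm d (suc b)) 1+b+d≡a))

      0^a𝟏-as-prefix : 0^ suc b ++ 0^ d ∷ʳ 𝟏 ≡ 0^ a ∷ʳ 𝟏
      0^a𝟏-as-prefix = trans (sym (++-assoc (0^ suc b) (0^ d) [ 𝟏 ]))
        (cong (_∷ʳ 𝟏) (trans (replicate-++ (suc b) d 𝟎) (cong 0^_ 1+b+d≡a)))

      φ-surround-𝟎 : (0^ d ++ 0^ suc b) ++ 𝟏 ∷ φ a b w ++ 0^ suc b ++ 0^ d ∷ʳ 𝟏 ≡ φ a b (surround 𝟎 w)
      φ-surround-𝟎 = trans (cong₂ (λ t t′ → t ++ 𝟏 ∷ φ a b w ++ t′) 0^a-as-suffix 0^a𝟏-as-prefix)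
        (sym (φ-surround 𝟎 w))

  module Injective (a≢b : a ≢ b) where

    zerosOf-injective : ∀ c d → zerosOf c ≡ zerosOf d → c ≡ d
    zerosOf-injective 𝟎 𝟎 _   = refl
    zerosOf-injective 𝟎 𝟏 a≡b = ⊥-elim (a≢b a≡b)
    zerosOf-injective 𝟏 𝟎 b≡a = ⊥-elim (a≢b (sym b≡a))
    zerosOf-injective 𝟏 𝟏 _   = refl

    φ-prefix : ∀ w v {z} → φ a b w ++ z ≡ φ a b v → ∃ λ v′ → v ≡ w ++ v′ × z ≡ φ a b v′
    φ-prefix []      v       eq = v , refl , eq
    φ-prefix (c ∷ w) []      eq = ⊥-elim (0^-𝟏-≢-[] (zerosOf c) (trans (sym (φ-∷-++ c w _)) eq))
    φ-prefix (c ∷ w) (d ∷ v) eq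
      with 0^-𝟏-injective (zerosOf c) (zerosOf d) (trans (sym (φ-∷-++ c w _)) (trans eq (φ-∷ d v)))
    ... | c≡d , rest with zerosOf-injective c d c≡d | φ-prefix w v rest
    ...   | refl | v′ , refl , z≡ = v′ , refl , z≡

    φ-injective : ∀ u v → φ a b u ≡ φ a b v → u ≡ v
    φ-injective u v eq with φ-prefix u v (trans (++-identityʳ (φ a b u)) eq)
    ... | []     , v≡u++[] , _   = sym (trans v≡u++[] (++-identityʳ u))
    ... | c ∷ v′ , _       , []≡ = ⊥-elim (0^-𝟏-≢-[] (zerosOf c) (sym (trans []≡ (φ-∷ c v′))))

    palindrome-0^-𝟏-φ-0^ : ∀ j w k → Palindrome (0^ j ++ 𝟏 ∷ φ a b w ++ 0^ k) → k ≡ j × Palindrome w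
    palindrome-0^-𝟏-φ-0^ j w k pal with 0^-𝟏-injective k j (trans (sym (reverse-0^-𝟏-φ-0^ j w k)) pal)
    ... | refl , φrw≡φw = refl , φ-injective _ _ (++-cancelʳ (0^ k) _ _ φrw≡φw)

    surround-T-desubst-𝟏 : ∀ w {v} → Factor (surround 𝟏 (T a b w)) (φ a b v) → Factor (surround 𝟏 w) v
    surround-T-desubst-𝟏 w {v} (x , y , eq) with φ-split-at-𝟏 v x eq
    ... | v₁ , c , v₂ , refl , _ , r≡ with φ-prefix (surround 𝟏 w) v₂ (trans (cong (_++ y) (sym (T-∷ʳ-𝟏 w))) r≡)
    ...   | v′ , refl , _ = v₁ ∷ʳ c , v′ , ++-assoc v₁ [ c ] _

    surround-T-desubst-𝟎 : ∀ w {v} → Factor (surround 𝟎 (T a b w)) (φ a b v) → Factor (surround 𝟎 w) v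
    surround-T-desubst-𝟎 w {v} f with subst (λ u → Factor u (φ a b v)) (surround-𝟎-T w) f
    ... | x , y , eq with φ-split-at-𝟏 v (x ++ 0^ suc b) (trans (++-regroup x (0^ suc b) _ y) eq)
    ...   | v₁ , 𝟏 , _ , _ , x0≡ , _ =
      ⊥-elim (φ-≢-∷ʳ-𝟎 v₁ x (sym (++-cancelʳ (0^ b) _ _ (trans (++-assoc x [ 𝟎 ] (0^ b)) x0≡))))
    ...   | v₁ , 𝟎 , v₂ , refl , _ , r≡ with φ-prefix w v₂ (trans (sym (++-assoc (φ a b w) (0^ suc b) y)) r≡)
    ...     | []      , _    , ()
    ...     | 𝟏 ∷ v″ , _    , 0y≡ with ++-cancelˡ (0^ b) _ _ (trans (replicate-++-∷ b 𝟎 y) (trans 0y≡ (φ-∷ 𝟏 v″)))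
    ...       | ()
    surround-T-desubst-𝟎 w f | _ | v₁ , 𝟎 , _ , refl , _ , _ | 𝟎 ∷ v″ , refl , _ =
      v₁ , v″ , cong (λ t → v₁ ++ 𝟎 ∷ t) (++-assoc w [ 𝟎 ] v″)

  TwoPalindromicExtensions : Word → Set
  TwoPalindromicExtensions p = InL a b (surround 𝟎 p) × InL a b (surround 𝟏 p)

  InL-factor : ∀ {u v} → Factor u v → InL a b v → InL a b u
  InL-factor f (n , g) = n , factor-trans f g

  InL-φ : ∀ {u} → InL a b u → InL a b (φ a b u)
  InL-φ (n , f) = suc n , φ-factor f

module Language {a b : ℕ} (b<a : b < a) where

  open Morphism a b
  open Injective (λ a≡b → <⇒≢ b<a (sym a≡b))

  1≤a : 1 ≤ a
  1≤a = ≤-trans (s≤s z≤n) b<a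

  φⁿ0-head : ∀ n → ∃ λ t → φⁿ0 a b n ≡ 𝟎 ∷ t
  φⁿ0-head zero    = [] , refl
  φⁿ0-head (suc n) with φⁿ0-head n
  ... | t , e with 0^-head 1≤a (𝟏 ∷ φ a b t)
  ...   | t′ , e′ = t′ , trans (cong (φ a b) e) (trans (φ-∷ 𝟎 t) e′)

  InL⇒factor-φ : ∀ {w} → InL a b w → ∃ λ n → Factor w (φ a b (φⁿ0 a b n))
  InL⇒factor-φ (zero  , f) with φⁿ0-head 1
  ... | t , e = zero , factor-trans f ([] , t , sym e)
  InL⇒factor-φ (suc n , f) = n , f

  InL-desubstitute : ∀ {u u′} → (∀ {v} → Factor u (φ a b v) → Factor u′ v) → InL a b u → InL a b u′
  InL-desubstitute desubst h with InL⇒factor-φ h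
  ... | n , f = n , desubst f

  InL-𝟏-left-extension : ∀ {w} → InL a b (𝟏 ∷ w) → ∃ λ d → InL a b (d ∷ 𝟏 ∷ w)
  InL-𝟏-left-extension (n , x , y , eq) with initLast x | φⁿ0-head n
  ... | []        | _ , e with trans eq e
  ...   | ()
  InL-𝟏-left-extension (n , _ , y , eq) | x ∷ʳ′ d | _ = d , n , x , y , trans (sym (++-assoc x [ d ] _)) eq

  InL-0^-bound : ∀ {m} → InL a b (0^ m) → m ≤ a
  InL-0^-bound h with InL⇒factor-φ h
  ... | n , f = φ-0^-bound (<⇒≤ b<a) (φⁿ0 a b n) f

  0^1+a∉L : ∀ {s} → ¬ InL a b (𝟎 ∷ 0^ a ++ s)
  0^1+a∉L {s} h = 1+n≰n (InL-0^-bound (InL-factor ([] , s , refl) h))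

  TwoExt⇒0^b⊎T : ∀ {p} → Palindrome p → TwoPalindromicExtensions p →
    p ≡ 0^ b ⊎ ∃ λ w → Palindrome w × p ≡ T a b w
  TwoExt⇒0^b⊎T pal (e₀ , e₁) with InL⇒factor-φ e₁
  ... | n , f with φ-factor-surround-𝟏 (φⁿ0 a b n) f
  ...   | []     , 𝟏 , p≡0^b = inj₁ p≡0^b
  ...   | []     , 𝟎 , refl = ⊥-elim (0^1+a∉L e₀)
  ...   | 𝟎 ∷ w , c , refl =
    ⊥-elim (0^1+a∉L (subst (λ t → InL a b (𝟎 ∷ t)) (trans (++-assoc (φ a b (𝟎 ∷ w)) _ [ 𝟎 ]) (φ-∷-++ 𝟎 w _)) e₀))
  ...   | 𝟏 ∷ w , c , refl with palindrome-0^-𝟏-φ-0^ b w (zerosOf c) (subst Palindrome (φ-∷-++ 𝟏 w _) pal)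
  ...     | k≡b , w-pal = inj₂ (w , w-pal , trans (φ-∷-++ 𝟏 w _) (cong (λ k → 0^ b ++ 𝟏 ∷ φ a b w ++ 0^ k) k≡b))

  TwoExt-T⇒TwoExt : ∀ w → TwoPalindromicExtensions (T a b w) → TwoPalindromicExtensions w
  TwoExt-T⇒TwoExt w (e₀ , e₁) =
    InL-desubstitute (surround-T-desubst-𝟎 w) e₀ , InL-desubstitute (surround-T-desubst-𝟏 w) e₁

  TwoExt⇒TwoExt-T : ∀ w → TwoPalindromicExtensions w → TwoPalindromicExtensions (T a b w)
  TwoExt⇒TwoExt-T w (e₀ , e₁) with InL-𝟏-left-extension e₁
  ... | d , e₁′ = InL-factor (surround-T-factor-𝟎 b<a w) (InL-φ e₀) , InL-factor (surround-T-factor-𝟏 d w) (InL-φ e₁′)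

  TwoExt-0^b : 2 + b ≤ a → TwoPalindromicExtensions (0^ b)
  TwoExt-0^b 2+b≤a = InL-factor 0^b+2-factor (InL-φ 𝟎∈L) , InL-factor 𝟏0^b𝟏-factor (InL-φ 𝟎𝟏∈L)
    where
      𝟎∈L : InL a b [ 𝟎 ]
      𝟎∈L = zero , [] , [] , refl
      𝟎𝟏∈L : InL a b (𝟎 ∷ 𝟏 ∷ [])
      𝟎𝟏∈L with 0^-last 1≤a [ 𝟏 ]
      ... | x , e = 1 , x , [] , trans e (sym (++-identityʳ _))
      0^b+2-factor : Factor (surround 𝟎 (0^ b)) (φ a b [ 𝟎 ])
      0^b+2-factor with 0^-prefix 2+b≤a [ 𝟏 ]
      ... | y , e = [] , y , trans (cong (λ t → 𝟎 ∷ t ++ y) (replicate-∷ʳ b 𝟎)) (trans e (sym (φ-∷ 𝟎 [])))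
      𝟏0^b𝟏-factor : Factor (surround 𝟏 (0^ b)) (φ a b (𝟎 ∷ 𝟏 ∷ []))
      𝟏0^b𝟏-factor = 0^ a , [] , trans (cong (0^ a ++_) (++-identityʳ _))
        (sym (trans (φ-∷ 𝟎 [ 𝟏 ]) (cong (λ t → 0^ a ++ 𝟏 ∷ t) (φ-∷ 𝟏 []))))

  V-TwoExt : 2 + b ≤ a → ∀ m → TwoPalindromicExtensions (V a b (suc m))
  V-TwoExt 2+b≤a zero    = TwoExt-0^b 2+b≤a
  V-TwoExt 2+b≤a (suc m) = TwoExt⇒TwoExt-T _ (V-TwoExt 2+b≤a m)

  TwoExt⇒V : ∀ p → Acc _<_ (length p) → Palindrome p → TwoPalindromicExtensions p → ∃ λ m → p ≡ V a b (suc m)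
  TwoExt⇒V p (acc rs) pal e with TwoExt⇒0^b⊎T pal e
  ... | inj₁ p≡0^b = zero , p≡0^b
  ... | inj₂ (w , w-pal , refl) with TwoExt⇒V w (rs (length-T w)) w-pal (TwoExt-T⇒TwoExt w e)
  ...   | m , w≡V = suc m , cong (T a b) w≡V

proposition5p5 : (a b : ℕ) → 1 ≤ b → b + 1 < a →
    (p : Word) → Palindrome p → InL a b p →
    ((InL a b (𝟎 ∷ p ++ [ 𝟎 ]) × InL a b (𝟏 ∷ p ++ [ 𝟏 ]))
      ⇔ Σ ℕ (λ n → 1 ≤ n × p ≡ V a b n))
proposition5p5 a b _ b+1<a p pal _ = mk⇔
  (λ e → let m , p≡V = TwoExt⇒V p (<-wellFounded (length p)) pal e in suc m , s≤s z≤n , p≡V)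
  (λ { (zero , () , _) ; (suc m , _ , refl) → V-TwoExt 2+b≤a m })
  where
    2+b≤a : 2 + b ≤ a
    2+b≤a = subst (λ k → suc k ≤ a) (+-comm b 1) b+1<a
    open Language (m+n≤o⇒m≤o (suc b) b+1<a)
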